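{- Let $\mathbf v=\mathbf v_{a_rb_r}\cdots\mathbf v_{a_1b_1}$ and $\mathbf v'=\mathbf v_{c_rd_r}\cdots\mathbf v_{c_1d_1}$ be compositions of operators with $\mathbf v\equiv\mathbf v'\not\equiv\mathbf 0$. Then $\mathrm{supp}(\mathbf v)=\mathrm{supp}(\mathbf v')$.
   Context: For a positive integer $N$, $[N]=\{1,\dots,N\}$, $S_N$ is the symmetric group on $[N]$, $s_{ab}$ is the transposition exchanging $a$ and $b$, and $\ell(w)$ is the number of inversions. Let $q_1,\dots,q_{N-1}$ be commuting indeterminates; $\mathbf q^\alpha=\prod_i q_i^{\alpha_i}$ for $\alpha\in\mathbb Z_{\ge0}^{N-1}$, and $\mathbf q_{ij}=q_i\cdots q_{j-1}$ for $i<j$. $S_N[\mathbf q]=\{\mathbf q^\alpha w: w\in S_N\}$ with $\ell(\mathbf q^\alpha w)=\ell(w)+2\deg\mathbf q^\alpha$. For $k\in[N-1]$ the quantum $k$-Bruhat order has covers: for $w\in S_N$, $i\le k<j$, $w\lessdot_k ws_{ij}$ if $\ell(ws_{ij})=\ell(w)+1$ (i.e. $w(i)<w(j)$ and no $l\in(i,j)$ has $w(i)<w(l)<w(j)$), $w\lessdot_k\mathbf q_{ij}ws_{ij}$ if $\ell(\mathbf q_{ij}ws_{ij})=\ell(w)+1$ (i.e. $w(i)>w(j)$ and all $l\in(i,j)$ have $w(j)<w(l)<w(i)$), extended $\mathbf q$-multiplicatively. Operators $\mathbf v_{ab}$ ($a\ne b$ positive integers) generate a free monoid; a composition $\mathbf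 v_{a_rb_r}\cdots\mathbf v_{a_1b_1}$ has support $\mathrm{supp}=\{a_1,b_1,\dots,a_r,b_r\}$; $\mathbf 0$ is a zero element. For support in $[N]$ and $k\in[N-1]$, the action on $S_N[\mathbf q]\cup\{0\}$ is: for $u\in S_N$, $\mathbf v_{ab}\bullet_ku=s_{ab}u$ if $a<b$ and $u\lessdot_k s_{ab}u$; $=\mathbf q_{ij}s_{ab}u$ if $a>b$, $i=u^{ -1}(a)$, $j=u^{ -1}(b)$, and $u\lessdot_k\mathbf q_{ij}s_{ab}u$; $=0$ otherwise; extended by $\mathbf v\bullet_k(\mathbf q^\alpha u)=\mathbf q^\alpha(\mathbf v\bullet_ku)$, $\bullet_k0=0$, and compositions act by applying the rightmost operator first. $\mathbf v\equiv\mathbf v'$ means $\mathbf v\bullet_kx=\mathbf v'\bullet_kx$ for all $N$ containing both supports in $[N]$, all $x\in S_N[\mathbf q]$, all $k\in[N-1]$; $\mathbf v\equiv\mathbf 0$ means the action is always $0$. -}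

module Defs where

open import Data.Nat using (ℕ; zero; suc; _+_; _*_; _∸_; _≤_; _<_; _≟_; _<?_; _≤?_; _≡ᵇ_)
open import Data.Bool using (Bool; true; false; if_then_else_)
open import Data.List using (List; []; _∷_; map; upTo; filter; length; concatMap)
open import Data.List.Membership.Propositional using (_∈_)
open import Data.List.Relation.Binary.Permutation.Propositional using (_↭_)
open import Data.Vec using (Vec; tabulate; zipWith)
open import Data.Fin using (Fin; toℕ)
open import Data.Maybe using (Maybe; just; nothing; _>>=_)
open import Data.Product using (_×_; _,_)
open import Relation.Nullary using (Dec; yes; no; ¬_)
open import Relation.Nullary.Decidable using (_×-dec_)
open import Relation.Binary.PropositionalEquality using (_≡_; _≢_)

-- Permutations of [N] in one-line notation: u = [u(1), …, u(N)].

IsPerm : ℕ → List ℕ → Set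
IsPerm N u = u ↭ map suc (upTo N)

-- u(i) for a 1-based position i
at : List ℕ → ℕ → ℕ
at []       _             = 0
at (x ∷ xs) zero          = 0
at (x ∷ xs) (suc zero)    = x
at (x ∷ xs) (suc (suc n)) = at xs (suc n)

-- u⁻¹(a), 1-based (only meaningful when a occurs in u)
pos : ℕ → List ℕ → ℕ
pos a []       = 0
pos a (x ∷ xs) = if x ≡ᵇ a then 1 else suc (pos a xs)

-- s_{ab} u  (left multiplication: exchange the values a and b)
swapVals : ℕ → ℕ → List ℕ → List ℕ
swapVals a b = map (λ x → if x ≡ᵇ a then b else if x ≡ᵇ b then a else x)

ℓ : List ℕ → ℕ
ℓ []       = 0
ℓ (x ∷ xs) = length (filter (λ y → y <? x) xs) + ℓ xs

-- Elements of S_N[q]: pairs (α , w), standing for q^α w,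
-- with α ∈ ℕ^{N-1} (α_m is the exponent of q_{m+1}).

Mono : ℕ → Set
Mono N = Vec ℕ (N ∸ 1)

Elt : ℕ → Set
Elt N = Mono N × List ℕ

-- q_{ij} = q_i ⋯ q_{j-1}  (exponent 1 at q_m for i ≤ m < j)
qij : (N i j : ℕ) → Mono N
qij N i j = tabulate (λ m → if (i Data.Nat.≤ᵇ suc (toℕ m)) Data.Bool.∧ (suc (toℕ m) Data.Nat.<ᵇ j) then 1 else 0)

_·_ : {N : ℕ} → Vec ℕ N → Vec ℕ N → Vec ℕ N
α · β = zipWith _+_ α β

-- Action of a single operator v_{ab} on u ∈ S_N (result: Maybe = S_N[q] ∪ {0}).
--
-- a < b : with i < j the two positions of a and b in u, s_{ab} u = u s_{ij},
--         and u ⋖_k s_{ab} u  iff  i ≤ k < j and ℓ(u s_{ij}) = ℓ(u) + 1.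
-- a > b : i = u⁻¹(a), j = u⁻¹(b); u ⋖_k q_{ij} s_{ab} u  iff  i ≤ k < j and
--         ℓ(q_{ij} u s_{ij}) = ℓ(u s_{ij}) + 2 deg q_{ij} = ℓ(u) + 1,
--         where deg q_{ij} = j - i.

minℕ maxℕ : ℕ → ℕ → ℕ
minℕ = Data.Nat._⊓_
maxℕ = Data.Nat._⊔_

act₁ : (N k : ℕ) → ℕ × ℕ → List ℕ → Maybe (Elt N)
act₁ N k (a , b) u with a <? b
... | yes _ with (i ≤? k) ×-dec (k <? j) ×-dec (ℓ w ≟ suc (ℓ u))
  where i = minℕ (pos a u) (pos b u)
        j = maxℕ (pos a u) (pos b u)
        w = swapVals a b u
...   | yes _ = just (tabulate (λ _ → 0) , swapVals a b u)
...   | no  _ = nothing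
act₁ N k (a , b) u | no _ with (i ≤? k) ×-dec (k <? j) ×-dec (ℓ w + 2 * (j ∸ i) ≟ suc (ℓ u))
  where i = pos a u
        j = pos b u
        w = swapVals a b u
...   | yes _ = just (qij N (pos a u) (pos b u) , swapVals a b u)
...   | no  _ = nothing

actElt : (N k : ℕ) → ℕ × ℕ → Elt N → Maybe (Elt N)
actElt N k o (α , u) with act₁ N k o u
... | just (β , w) = just (α · β , w)
... | nothing      = nothing

-- A composition v_{a_r b_r} ⋯ v_{a_1 b_1} is the list
-- (a_r , b_r) ∷ … ∷ (a_1 , b_1) ∷ []; the rightmost operator acts first.
Word : Set
Word = List (ℕ × ℕ)

act : (N k : ℕ) → Word → Elt N → Maybe (Elt N)
act N k []       x = just x
act N k (o ∷ os) x = act N k os x >>= actElt N k o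

ValidOp : ℕ × ℕ → Set
ValidOp (a , b) = (1 ≤ a) × (1 ≤ b) × (a ≢ b)

supp : Word → List ℕ
supp = concatMap (λ { (a , b) → a ∷ b ∷ [] })

SuppIn : ℕ → Word → Set
SuppIn N v = ∀ x → x ∈ supp v → (1 ≤ x) × (x ≤ N)

_≣_ : Word → Word → Set
v ≣ v' = ∀ N → SuppIn N v → SuppIn N v' →
         ∀ k → 1 ≤ k → k < N →
         ∀ (α : Mono N) (u : List ℕ) → IsPerm N u →
         act N k v (α , u) ≡ act N k v' (α , u)

IsZero : Word → Set
IsZero v = ∀ N → SuppIn N v →
           ∀ k → 1 ≤ k → k < N →
           ∀ (α : Mono N) (u : List ℕ) → IsPerm N u →
           act N k v (α , u) ≡ nothing

module Submission where

-- A nonzero step v_{ab} • u = q^β w swaps the values a and b of u, where a stands left of b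
-- and the entries between them are either all outside the value range (a, b) (a Bruhat
-- cover, β = 0) or all inside (b, a) (a quantum cover, q^β = q_{ij}).  Let rank t m (q^α w)
-- be the number of entries ≥ t among w(1), …, w(m+1) plus the exponent of q_{m+1}, the
-- variable sitting at the cut between positions m+1 and m+2.  Every rank weakly increases
-- along a step.  For a value c at position p, the potential rank (c+1) (p-1) + rank c (p-2)
-- strictly increases at a step involving c (the first term registers steps where c plays a,
-- the second those where it plays b), while a step not involving c changes neither p nor the
-- potential.  So if v and v' carry the same permutation to the same nonzero element, each
-- c ∈ supp v lies in supp v'.  When v ≡ v' ≢ 0 such a common run exists once N is enlarged
-- by fixed points.

open import Defs
open import Data.Bool using (true; false; T; if_then_else_; _∧_)
open import Data.Bool.Properties using (T-≡; T-∧)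
open import Data.Empty using (⊥-elim)
open import Data.Fin using (toℕ)
open import Data.List using (List; []; _∷_; _++_; [_]; length; filter; map; upTo; take)
open import Data.List.Membership.Propositional using (_∈_; _∉_)
open import Data.List.Membership.Propositional.Properties
  using (∈-∃++; ∈-++⁻; ∈-++⁺ˡ; ∈-++⁺ʳ; ∈-map⁺; ∈-map⁻; ∈-upTo⁺; ∈-upTo⁻)
open import Data.List.Properties
  using (++-assoc; length-++; map-++; map-id-local; length-map; length-upTo; upTo-∷ʳ;
         filter-++; filter-accept; filter-reject; length-filter; filter-complete; filter-some)
open import Data.List.Relation.Binary.Permutation.Propositional
  using (_↭_; ↭-prep; ↭-swap; ↭-refl; ↭-sym; ↭-trans; ↭⇒↭ₛ)
open import Data.List.Relation.Binary.Permutation.Propositional.Properties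
  using (shift; ++⁺ˡ; ++⁺ʳ; ↭-length; ∈-resp-↭; filter-↭)
open import Data.List.Relation.Unary.All as All using (All; []; _∷_)
open import Data.List.Relation.Unary.All.Properties using (All¬⇒¬Any; all-filter; ¬Any⇒All¬)
open import Data.List.Relation.Unary.Any using (here; there)
open import Data.List.Relation.Unary.Unique.Propositional using (Unique; []; _∷_)
open import Data.List.Relation.Unary.Unique.Propositional.Properties using (map⁺; upTo⁺)
open import Data.Maybe using (just; nothing; _>>=_)
open import Data.Nat
  using (ℕ; zero; suc; pred; _+_; _*_; _∸_; _≤_; _<_; z≤n; s≤s; _≟_; _<?_; _≤?_; _≡ᵇ_; _≤ᵇ_; _<ᵇ_)
open import Data.Nat.ListAction using (sum)
open import Data.Nat.Properties
open import Data.Nat.Tactic.RingSolver using (solve-∀)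
open import Data.List.Membership.DecPropositional _≟_ using (_∈?_)
open import Data.Product using (_×_; _,_; proj₁; proj₂; ∃; ∃₂; swap)
open import Data.Sum using (_⊎_; inj₁; inj₂)
open import Data.Unit using (tt)
open import Data.Vec using (Vec; []; _∷_; tabulate)
open import Function using (_∘_; _⇔_; mk⇔; Equivalence)
open import Relation.Binary.Definitions using (tri<; tri≈; tri>)
open import Relation.Binary.PropositionalEquality
  using (_≡_; _≢_; refl; sym; trans; cong; cong₂; subst; subst₂; module ≡-Reasoning)
open import Relation.Binary.PropositionalEquality.Properties using (setoid)
open import Data.List.Relation.Binary.Permutation.Setoid.Properties (setoid ℕ) using (Unique-resp-↭)
open import Relation.Nullary using (¬_; Dec; yes; no; contradiction)
open import Relation.Nullary.Decidable using (_×-dec_; decidable-stable)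
open import Relation.Unary using (Decidable; ∁)

-- Counting and inversion numbers

count : {P : ℕ → Set} → Decidable P → List ℕ → ℕ
count P? xs = length (filter P? xs)

module _ {P : ℕ → Set} (P? : Decidable P) where

  count-++ : ∀ xs ys → count P? (xs ++ ys) ≡ count P? xs + count P? ys
  count-++ xs ys = trans (cong length (filter-++ P? xs ys)) (length-++ (filter P? xs))

  count-∷ : ∀ x xs → count P? (x ∷ xs) ≡ count P? [ x ] + count P? xs
  count-∷ x = count-++ [ x ]

  count-yes : ∀ {x} → P x → count P? [ x ] ≡ 1
  count-yes px = cong length (filter-accept P? px)

  count-no : ∀ {x} → ¬ P x → count P? [ x ] ≡ 0
  count-no ¬px = cong length (filter-reject P? ¬px)

  count-≤1 : ∀ x → count P? [ x ] ≤ 1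
  count-≤1 x = length-filter P? [ x ]

  count-↭ : ∀ {xs ys} → xs ↭ ys → count P? xs ≡ count P? ys
  count-↭ p = ↭-length (filter-↭ P? p)

  count≡length⇒All : ∀ xs → count P? xs ≡ length xs → All P xs
  count≡length⇒All xs e = subst (All P) (filter-complete P? e) (all-filter P? xs)

  count≡0⇒All∁ : ∀ xs → count P? xs ≡ 0 → All (∁ P) xs
  count≡0⇒All∁ xs e = ¬Any⇒All¬ xs (λ any → <⇒≢ (filter-some P? any) (sym e))

Between : ℕ → ℕ → ℕ → Set
Between x y z = x < z × z < y

between? : ∀ x y → Decidable (Between x y)
between? x y z = (x <? z) ×-dec (z <? y)

below above : ℕ → List ℕ → ℕ
below x = count (_<? x)
above x = count (x <?_)

below-singleton-flip : ∀ x y → below x [ y ] ≡ above y [ x ]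
below-singleton-flip x y with y <? x
... | yes y<x = trans (count-yes (_<? x) y<x) (sym (count-yes (y <?_) y<x))
... | no  y≮x = trans (count-no (_<? x) y≮x) (sym (count-no (y <?_) y≮x))

below-above-exchange₁ : ∀ {x y z} → x < y → z ≢ x → z ≢ y →
  above x [ z ] + below y [ z ] ≡ above y [ z ] + below x [ z ] + 2 * count (between? x y) [ z ]
below-above-exchange₁ {x} {y} {z} x<y z≢x z≢y with <-cmp z x
... | tri≈ _ z≡x _ = contradiction z≡x z≢x
... | tri< z<x _ _
  rewrite count-no (x <?_) (<⇒≯ z<x) | count-yes (_<? y) (<-trans z<x x<y)
        | count-no (y <?_) (<⇒≯ (<-trans z<x x<y)) | count-yes (_<? x) z<x
        | count-no (between? x y) (λ (x<z , _) → <⇒≯ z<x x<z) = refl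
... | tri> _ _ x<z with <-cmp z y
...   | tri≈ _ z≡y _ = contradiction z≡y z≢y
...   | tri< z<y _ _
  rewrite count-yes (x <?_) x<z | count-yes (_<? y) z<y
        | count-no (y <?_) (<⇒≯ z<y) | count-no (_<? x) (<⇒≯ x<z)
        | count-yes (between? x y) (x<z , z<y) = refl
...   | tri> _ _ y<z
  rewrite count-yes (x <?_) x<z | count-no (_<? y) (<⇒≯ y<z)
        | count-yes (y <?_) y<z | count-no (_<? x) (<⇒≯ x<z)
        | count-no (between? x y) (λ (_ , z<y) → <⇒≯ y<z z<y) = refl

below-above-exchange : ∀ {x y} → x < y → ∀ M → x ∉ M → y ∉ M →
  above x M + below y M ≡ above y M + below x M + 2 * count (between? x y) M
below-above-exchange x<y [] _ _ = refl
below-above-exchange {x} {y} x<y (z ∷ M) x∉zM y∉zM =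
  begin
    above x (z ∷ M) + below y (z ∷ M)
  ≡⟨ cong₂ _+_ (count-∷ (x <?_) z M) (count-∷ (_<? y) z M) ⟩
    (above x [ z ] + above x M) + (below y [ z ] + below y M)
  ≡⟨ +-exchange (above x [ z ]) (above x M) (below y [ z ]) (below y M) ⟩
    (above x [ z ] + below y [ z ]) + (above x M + below y M)
  ≡⟨ cong₂ _+_ (below-above-exchange₁ x<y (x∉zM ∘ here ∘ sym) (y∉zM ∘ here ∘ sym))
               (below-above-exchange x<y M (x∉zM ∘ there) (y∉zM ∘ there)) ⟩
    (above y [ z ] + below x [ z ] + 2 * count (between? x y) [ z ])
      + (above y M + below x M + 2 * count (between? x y) M)
  ≡⟨ regroup (above y [ z ]) (below x [ z ]) (count (between? x y) [ z ])
             (above y M) (below x M) (count (between? x y) M) ⟩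
    (above y [ z ] + above y M) + (below x [ z ] + below x M)
      + 2 * (count (between? x y) [ z ] + count (between? x y) M)
  ≡˘⟨ cong₂ _+_ (cong₂ _+_ (count-∷ (y <?_) z M) (count-∷ (_<? x) z M))
                (cong (2 *_) (count-∷ (between? x y) z M)) ⟩
    above y (z ∷ M) + below x (z ∷ M) + 2 * count (between? x y) (z ∷ M)
  ∎
  where
  open ≡-Reasoning
  +-exchange : ∀ p q r s → (p + q) + (r + s) ≡ (p + r) + (q + s)
  +-exchange = solve-∀
  regroup : ∀ p q r s t v → (p + q + 2 * r) + (s + t + 2 * v) ≡ (p + s) + (q + t) + 2 * (r + v)
  regroup = solve-∀

ℓ-insert : ∀ X w Y → ℓ (X ++ w ∷ Y) ≡ ℓ (X ++ Y) + above w X + below w Y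
ℓ-insert [] w Y = trans (+-comm (below w Y) (ℓ Y)) (cong (_+ below w Y) (sym (+-identityʳ (ℓ Y))))
ℓ-insert (z ∷ X) w Y =
  begin
    below z (X ++ w ∷ Y) + ℓ (X ++ w ∷ Y)
  ≡⟨ cong₂ _+_ (trans (count-++ (_<? z) X (w ∷ Y)) (cong (below z X +_) (count-∷ (_<? z) w Y)))
               (ℓ-insert X w Y) ⟩
    below z X + (below z [ w ] + below z Y) + (ℓ (X ++ Y) + above w X + below w Y)
  ≡⟨ cong (λ n → below z X + (n + below z Y) + (ℓ (X ++ Y) + above w X + below w Y))
          (below-singleton-flip z w) ⟩
    below z X + (above w [ z ] + below z Y) + (ℓ (X ++ Y) + above w X + below w Y)
  ≡⟨ regroup (below z X) (above w [ z ]) (below z Y) (ℓ (X ++ Y)) (above w X) (below w Y) ⟩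
    (below z X + below z Y) + ℓ (X ++ Y) + (above w [ z ] + above w X) + below w Y
  ≡˘⟨ cong₂ (λ p q → p + ℓ (X ++ Y) + q + below w Y) (count-++ (_<? z) X Y) (count-∷ (w <?_) z X) ⟩
    below z (X ++ Y) + ℓ (X ++ Y) + above w (z ∷ X) + below w Y
  ∎
  where
  open ≡-Reasoning
  regroup : ∀ p q r s t v → p + (q + r) + (s + t + v) ≡ (p + r) + s + (q + t) + v
  regroup = solve-∀

ℓ-pair : ∀ L x M y R → ℓ (L ++ x ∷ M ++ y ∷ R) ≡
  ℓ (L ++ M ++ R) + (above x L + above y L) + (below x R + below y R)
    + (below x M + above y M) + below x [ y ]
ℓ-pair L x M y R =
  begin
    ℓ (L ++ x ∷ M ++ y ∷ R)
  ≡⟨ ℓ-insert L x (M ++ y ∷ R) ⟩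
    ℓ (L ++ M ++ y ∷ R) + above x L + below x (M ++ y ∷ R)
  ≡⟨ cong₂ (λ p q → p + above x L + q) ℓ-inner below-x ⟩
    ℓ (L ++ M ++ R) + (above y L + above y M) + below y R + above x L
      + (below x M + (below x [ y ] + below x R))
  ≡⟨ regroup (ℓ (L ++ M ++ R)) (above y L) (above y M) (below y R) (above x L)
             (below x M) (below x [ y ]) (below x R) ⟩
    ℓ (L ++ M ++ R) + (above x L + above y L) + (below x R + below y R)
      + (below x M + above y M) + below x [ y ]
  ∎
  where
  open ≡-Reasoning
  ℓ-inner : ℓ (L ++ M ++ y ∷ R) ≡ ℓ (L ++ M ++ R) + (above y L + above y M) + below y R
  ℓ-inner =
    begin
      ℓ (L ++ M ++ y ∷ R)
    ≡˘⟨ cong ℓ (++-assoc L M (y ∷ R)) ⟩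
      ℓ ((L ++ M) ++ y ∷ R)
    ≡⟨ ℓ-insert (L ++ M) y R ⟩
      ℓ ((L ++ M) ++ R) + above y (L ++ M) + below y R
    ≡⟨ cong₂ (λ p q → ℓ p + q + below y R) (++-assoc L M R) (count-++ (y <?_) L M) ⟩
      ℓ (L ++ M ++ R) + (above y L + above y M) + below y R
    ∎
  below-x : below x (M ++ y ∷ R) ≡ below x M + (below x [ y ] + below x R)
  below-x = trans (count-++ (_<? x) M (y ∷ R)) (cong (below x M +_) (count-∷ (_<? x) y R))
  regroup : ∀ b p q r s t u v → b + (p + q) + r + s + (t + (u + v)) ≡ b + (s + p) + (v + r) + (t + q) + u
  regroup = solve-∀

ℓ-transpose : ∀ {x y} → x < y → ∀ L M R → x ∉ M → y ∉ M →
  ℓ (L ++ y ∷ M ++ x ∷ R) ≡ ℓ (L ++ x ∷ M ++ y ∷ R) + suc (2 * count (between? x y) M)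
ℓ-transpose {x} {y} x<y L M R x∉M y∉M =
  begin
    ℓ (L ++ y ∷ M ++ x ∷ R)
  ≡⟨ ℓ-pair L y M x R ⟩
    Fʸˣ + (below y M + above x M) + below y [ x ]
  ≡⟨ cong₂ (λ p q → Fʸˣ + p + q)
           (trans (+-comm (below y M) (above x M)) (below-above-exchange x<y M x∉M y∉M))
           (count-yes (_<? y) x<y) ⟩
    Fʸˣ + (above y M + below x M + 2 * C) + 1
  ≡⟨ regroup (ℓ (L ++ M ++ R)) (above y L) (above x L) (below y R) (below x R) (above y M) (below x M) C ⟩
    Fˣʸ + (below x M + above y M) + 0 + suc (2 * C)
  ≡˘⟨ cong (λ q → Fˣʸ + (below x M + above y M) + q + suc (2 * C)) (count-no (_<? x) (<⇒≯ x<y)) ⟩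
    Fˣʸ + (below x M + above y M) + below x [ y ] + suc (2 * C)
  ≡˘⟨ cong (_+ suc (2 * C)) (ℓ-pair L x M y R) ⟩
    ℓ (L ++ x ∷ M ++ y ∷ R) + suc (2 * C)
  ∎
  where
  open ≡-Reasoning
  Fˣʸ = ℓ (L ++ M ++ R) + (above x L + above y L) + (below x R + below y R)
  Fʸˣ = ℓ (L ++ M ++ R) + (above y L + above x L) + (below y R + below x R)
  C = count (between? x y) M
  regroup : ∀ l p q r s t v c → l + (p + q) + (r + s) + (t + v + 2 * c) + 1
                               ≡ l + (q + p) + (s + r) + (v + t) + 0 + suc (2 * c)
  regroup = solve-∀

ℓ-classical-cover : ∀ {a b} L M R → a < b → a ∉ M → b ∉ M →
  ℓ (L ++ b ∷ M ++ a ∷ R) ≡ suc (ℓ (L ++ a ∷ M ++ b ∷ R)) → count (between? a b) M ≡ 0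
ℓ-classical-cover {a} {b} L M R a<b a∉M b∉M ℓ-up =
  *-cancelˡ-≡ _ 0 2 (suc-injective (+-cancelˡ-≡ (ℓ u) _ _
  (begin
    ℓ u + suc (2 * count (between? a b) M)  ≡˘⟨ ℓ-transpose a<b L M R a∉M b∉M ⟩
    ℓ (L ++ b ∷ M ++ a ∷ R)                 ≡⟨ ℓ-up ⟩
    suc (ℓ u)                               ≡⟨ +-comm 1 (ℓ u) ⟩
    ℓ u + 1                                 ∎)))
  where
  open ≡-Reasoning
  u = L ++ a ∷ M ++ b ∷ R

ℓ-quantum-cover : ∀ {a b} L M R → b < a → a ∉ M → b ∉ M →
  ℓ (L ++ b ∷ M ++ a ∷ R) + 2 * suc (length M) ≡ suc (ℓ (L ++ a ∷ M ++ b ∷ R)) →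
  count (between? b a) M ≡ length M
ℓ-quantum-cover {a} {b} L M R b<a a∉M b∉M ℓ-eq =
  sym (suc-injective (*-cancelˡ-≡ _ _ 2 (+-cancelˡ-≡ (ℓ w) _ _
    (begin
      ℓ w + 2 * suc (length M)  ≡⟨ ℓ-eq ⟩
      suc (ℓ (L ++ a ∷ M ++ b ∷ R))  ≡⟨ cong suc (ℓ-transpose b<a L M R b∉M a∉M) ⟩
      suc (ℓ w + suc (2 * C))   ≡⟨ rearrange (ℓ w) C ⟩
      ℓ w + 2 * suc C           ∎))))
  where
  open ≡-Reasoning
  w = L ++ b ∷ M ++ a ∷ R
  C = count (between? b a) M
  rearrange : ∀ l c → suc (l + suc (2 * c)) ≡ l + 2 * suc c
  rearrange = solve-∀

ℓ-snoc-max : ∀ {y} u → All (_< y) u → ℓ (u ++ [ y ]) ≡ ℓ u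
ℓ-snoc-max [] [] = refl
ℓ-snoc-max {y} (x ∷ u) (x<y ∷ u<y) = cong₂ _+_ below-x (ℓ-snoc-max u u<y)
  where
  below-x : below x (u ++ [ y ]) ≡ below x u
  below-x = trans (count-++ (_<? x) u [ y ])
                  (trans (cong (below x u +_) (count-no (_<? x) (<⇒≯ x<y))) (+-identityʳ _))

-- Positions, transpositions and permutations of [N]

≡ᵇ-refl : ∀ m → (m ≡ᵇ m) ≡ true
≡ᵇ-refl m = Equivalence.to T-≡ (≡⇒≡ᵇ m m refl)

≢⇒≡ᵇ-false : ∀ {m n} → m ≢ n → (m ≡ᵇ n) ≡ false
≢⇒≡ᵇ-false {m} {n} m≢n with m ≡ᵇ n | ≡ᵇ⇒≡ m n
... | false | _    = refl
... | true  | m≡n = contradiction (m≡n tt) m≢n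

pos-here : ∀ c X → pos c (c ∷ X) ≡ 1
pos-here c X rewrite ≡ᵇ-refl c = refl

pos-there : ∀ {c x} X → x ≢ c → pos c (x ∷ X) ≡ suc (pos c X)
pos-there X x≢c rewrite ≢⇒≡ᵇ-false x≢c = refl

pos-++-∉ : ∀ {c} X Y → c ∉ X → pos c (X ++ Y) ≡ length X + pos c Y
pos-++-∉ []      Y c∉X = refl
pos-++-∉ (x ∷ X) Y c∉X =
  trans (pos-there (X ++ Y) (λ x≡c → c∉X (here (sym x≡c)))) (cong suc (pos-++-∉ X Y (c∉X ∘ there)))

pos-++-∈ : ∀ {c} X Y → c ∈ X → pos c (X ++ Y) ≡ pos c X
pos-++-∈ (c ∷ X) Y (here refl) = trans (pos-here c (X ++ Y)) (sym (pos-here c X))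
pos-++-∈ {c} (x ∷ X) Y (there c∈X) with x ≡ᵇ c
... | true  = refl
... | false = cong suc (pos-++-∈ X Y c∈X)

pos-∈ : ∀ {c} X → c ∈ X → ∃ λ p → pos c X ≡ suc p × p < length X
pos-∈ (c ∷ X) (here refl) = 0 , pos-here c X , s≤s z≤n
pos-∈ {c} (x ∷ X) (there c∈X) with x ≡ᵇ c | pos-∈ X c∈X
... | true  | _ = 0 , refl , s≤s z≤n
... | false | p , pos≡ , p<len = suc p , cong suc pos≡ , s≤s p<len

pos-split : ∀ {c} X Y → c ∉ X → pos c (X ++ c ∷ Y) ≡ suc (length X)
pos-split {c} X Y c∉X =
  trans (pos-++-∉ X (c ∷ Y) c∉X) (trans (cong (length X +_) (pos-here c Y)) (+-comm (length X) 1))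

pos-replace : ∀ {c x x′} X Y → x ≢ c → x′ ≢ c → pos c (X ++ x ∷ Y) ≡ pos c (X ++ x′ ∷ Y)
pos-replace [] Y x≢c x′≢c = trans (pos-there Y x≢c) (sym (pos-there Y x′≢c))
pos-replace {c} (z ∷ X) Y x≢c x′≢c with z ≡ᵇ c
... | true  = refl
... | false = cong suc (pos-replace X Y x≢c x′≢c)

pos-transpose : ∀ {a b c} L M R → a ≢ c → b ≢ c →
  pos c (L ++ a ∷ M ++ b ∷ R) ≡ pos c (L ++ b ∷ M ++ a ∷ R)
pos-transpose {a} {b} {c} L M R a≢c b≢c =
  trans (pos-replace L (M ++ b ∷ R) a≢c b≢c)
  (trans (cong (pos c) (sym (++-assoc L (b ∷ M) (b ∷ R))))
  (trans (pos-replace (L ++ b ∷ M) R b≢c a≢c)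
         (cong (pos c) (++-assoc L (b ∷ M) (a ∷ R)))))

unique-middle : ∀ (X : List ℕ) {c} Y → Unique (X ++ c ∷ Y) → c ∉ X × c ∉ Y
unique-middle []      {c} Y (c∉Y ∷ _) = (λ ()) , All¬⇒¬Any c∉Y
unique-middle (x ∷ X) {c} Y (x∉ ∷ u) with unique-middle X Y u
... | c∉X , c∉Y = c∉xX , c∉Y
  where
  c∉xX : c ∉ x ∷ X
  c∉xX (here c≡x) = All.lookup x∉ (∈-++⁺ʳ X (here refl)) (sym c≡x)
  c∉xX (there c∈X) = c∉X c∈X

Avoids : ℕ → ℕ → List ℕ → Set
Avoids a b X = a ∉ X × b ∉ X

unique-transposition : ∀ {a b} (L M R : List ℕ) → Unique (L ++ a ∷ M ++ b ∷ R) →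
  Avoids a b L × Avoids a b M × Avoids a b R
unique-transposition {a} {b} L M R u = (a∉L , b∉L) , (a∉M , b∉M) , (a∉R , b∉R)
  where
  a-split : a ∉ L × a ∉ M ++ b ∷ R
  a-split = unique-middle L (M ++ b ∷ R) u
  b-split : b ∉ L ++ a ∷ M × b ∉ R
  b-split = unique-middle (L ++ a ∷ M) R (subst Unique (sym (++-assoc L (a ∷ M) (b ∷ R))) u)
  a∉L : a ∉ L
  a∉L = proj₁ a-split
  a∉M : a ∉ M
  a∉M = proj₂ a-split ∘ ∈-++⁺ˡ
  a∉R : a ∉ R
  a∉R = proj₂ a-split ∘ ∈-++⁺ʳ M ∘ there
  b∉L : b ∉ L
  b∉L = proj₁ b-split ∘ ∈-++⁺ˡ
  b∉M : b ∉ M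
  b∉M = proj₁ b-split ∘ ∈-++⁺ʳ L ∘ there
  b∉R : b ∉ R
  b∉R = proj₂ b-split

middle-avoids : ∀ {a b} (L M R : List ℕ) → Unique (L ++ a ∷ M ++ b ∷ R) → Avoids a b M
middle-avoids L M R = proj₁ ∘ proj₂ ∘ unique-transposition L M R

pos-first : ∀ {a b} L M R → Unique (L ++ a ∷ M ++ b ∷ R) →
  pos a (L ++ a ∷ M ++ b ∷ R) ≡ suc (length L)
pos-first L M R u = pos-split L (M ++ _ ∷ R) (proj₁ (proj₁ (unique-transposition L M R u)))

pos-second : ∀ {a b} L M R → Unique (L ++ a ∷ M ++ b ∷ R) →
  pos b (L ++ a ∷ M ++ b ∷ R) ≡ suc (length L + suc (length M))
pos-second {a} {b} L M R u =
  begin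
    pos b (L ++ a ∷ M ++ b ∷ R)
  ≡˘⟨ cong (pos b) (++-assoc L (a ∷ M) (b ∷ R)) ⟩
    pos b ((L ++ a ∷ M) ++ b ∷ R)
  ≡⟨ pos-split (L ++ a ∷ M) R (proj₁ (unique-middle (L ++ a ∷ M) R u′)) ⟩
    suc (length (L ++ a ∷ M))
  ≡⟨ cong suc (length-++ L) ⟩
    suc (length L + suc (length M))
  ∎
  where
  open ≡-Reasoning
  u′ : Unique ((L ++ a ∷ M) ++ b ∷ R)
  u′ = subst Unique (sym (++-assoc L (a ∷ M) (b ∷ R))) u

∈-last-segment : ∀ {a b c} (L M R : List ℕ) → c ∈ L ++ a ∷ M ++ b ∷ R →
  c ∉ L → a ≢ c → c ∉ M → b ≢ c → c ∈ R
∈-last-segment L M R c∈u c∉L a≢c c∉M b≢c with ∈-++⁻ L c∈u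
... | inj₁ c∈L          = contradiction c∈L c∉L
... | inj₂ (here c≡a)   = contradiction (sym c≡a) a≢c
... | inj₂ (there c∈MbR) with ∈-++⁻ M c∈MbR
...   | inj₁ c∈M         = contradiction c∈M c∉M
...   | inj₂ (here c≡b)  = contradiction (sym c≡b) b≢c
...   | inj₂ (there c∈R) = c∈R

pos-by-segment : ∀ {a b c} (L M R : List ℕ) → c ∈ L ++ a ∷ M ++ b ∷ R → a ≢ c → b ≢ c →
  let u = L ++ a ∷ M ++ b ∷ R in
    (∃ λ p → pos c u ≡ suc p × p < length L)
  ⊎ (c ∈ M × ∃ λ p → pos c u ≡ suc (suc (length L + p)) × p < length M)
  ⊎ (∃ λ p → pos c u ≡ suc (suc (suc (length L + length M + p))))
pos-by-segment {a} {b} {c} L M R c∈u a≢c b≢c with c ∈? L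
... | yes c∈L with pos-∈ L c∈L
...   | p , pos≡ , p<L = inj₁ (p , trans (pos-++-∈ L _ c∈L) pos≡ , p<L)
pos-by-segment {a} {b} {c} L M R c∈u a≢c b≢c | no c∉L with c ∈? M
... | yes c∈M with pos-∈ M c∈M
...   | p , pos≡ , p<M = inj₂ (inj₁ (c∈M , p , pos-M , p<M))
  where
  open ≡-Reasoning
  pos-M : pos c (L ++ a ∷ M ++ b ∷ R) ≡ suc (suc (length L + p))
  pos-M = begin
    pos c (L ++ a ∷ M ++ b ∷ R)          ≡⟨ pos-++-∉ L _ c∉L ⟩
    length L + pos c (a ∷ M ++ b ∷ R)    ≡⟨ cong (length L +_) (pos-there (M ++ b ∷ R) a≢c) ⟩
    length L + suc (pos c (M ++ b ∷ R))  ≡⟨ cong (λ q → length L + suc q) (pos-++-∈ M _ c∈M) ⟩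
    length L + suc (pos c M)             ≡⟨ cong (λ q → length L + suc q) pos≡ ⟩
    length L + suc (suc p)               ≡⟨ arrange (length L) p ⟩
    suc (suc (length L + p))             ∎
    where
    arrange : ∀ l p → l + suc (suc p) ≡ suc (suc (l + p))
    arrange = solve-∀
pos-by-segment {a} {b} {c} L M R c∈u a≢c b≢c | no c∉L | no c∉M
  with pos-∈ R (∈-last-segment L M R c∈u c∉L a≢c c∉M b≢c)
... | p , pos≡ , _ = inj₂ (inj₂ (p , pos-R))
  where
  open ≡-Reasoning
  pos-R : pos c (L ++ a ∷ M ++ b ∷ R) ≡ suc (suc (suc (length L + length M + p)))
  pos-R = begin
    pos c (L ++ a ∷ M ++ b ∷ R)
      ≡⟨ pos-++-∉ L _ c∉L ⟩
    length L + pos c (a ∷ M ++ b ∷ R)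
      ≡⟨ cong (length L +_) (pos-there (M ++ b ∷ R) a≢c) ⟩
    length L + suc (pos c (M ++ b ∷ R))
      ≡⟨ cong (λ q → length L + suc q) (pos-++-∉ M _ c∉M) ⟩
    length L + suc (length M + pos c (b ∷ R))
      ≡⟨ cong (λ q → length L + suc (length M + q)) (pos-there R b≢c) ⟩
    length L + suc (length M + suc (pos c R))
      ≡⟨ cong (λ q → length L + suc (length M + suc q)) pos≡ ⟩
    length L + suc (length M + suc (suc p))
      ≡⟨ arrange (length L) (length M) p ⟩
    suc (suc (suc (length L + length M + p)))
      ∎
    where
    arrange : ∀ l m p → l + suc (m + suc (suc p)) ≡ suc (suc (suc (l + m + p)))
    arrange = solve-∀

data Precedes (a b : ℕ) : List ℕ → Set where
  precedes : ∀ L M R → Precedes a b (L ++ a ∷ M ++ b ∷ R)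

precedes-or-follows : ∀ {a b u} → a ∈ u → b ∈ u → a ≢ b → Precedes a b u ⊎ Precedes b a u
precedes-or-follows {a} {b} a∈u b∈u a≢b with ∈-∃++ a∈u
... | L₁ , R₁ , refl with ∈-++⁻ L₁ b∈u
...   | inj₂ (here b≡a)    = contradiction (sym b≡a) a≢b
...   | inj₂ (there b∈R₁) with ∈-∃++ b∈R₁
...     | M , R , refl = inj₁ (precedes L₁ M R)
precedes-or-follows {a} {b} a∈u b∈u a≢b | L₁ , R₁ , refl | inj₁ b∈L₁ with ∈-∃++ b∈L₁
... | L , M , refl = inj₂ (subst (Precedes b a) (sym (++-assoc L (b ∷ M) (a ∷ R₁))) (precedes L M R₁))

swapVals-avoids : ∀ {a b} X → Avoids a b X → swapVals a b X ≡ X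
swapVals-avoids {a} {b} X (a∉X , b∉X) = map-id-local (All.tabulate fixed)
  where
  fixed : ∀ {z} → z ∈ X → (if z ≡ᵇ a then b else if z ≡ᵇ b then a else z) ≡ z
  fixed {z} z∈X rewrite ≢⇒≡ᵇ-false {z} {a} (λ z≡a → a∉X (subst (_∈ X) z≡a z∈X))
                      | ≢⇒≡ᵇ-false {z} {b} (λ z≡b → b∉X (subst (_∈ X) z≡b z∈X)) = refl

swapVals-left : ∀ a b → swapVals a b [ a ] ≡ [ b ]
swapVals-left a b rewrite ≡ᵇ-refl a = refl

swapVals-right : ∀ {a b} → a ≢ b → swapVals a b [ b ] ≡ [ a ]
swapVals-right {a} {b} a≢b rewrite ≢⇒≡ᵇ-false (a≢b ∘ sym) | ≡ᵇ-refl b = refl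

swapVals-transpose : ∀ {a b x y} L M R → swapVals a b [ x ] ≡ [ y ] → swapVals a b [ y ] ≡ [ x ] →
  Avoids a b L → Avoids a b M → Avoids a b R →
  swapVals a b (L ++ x ∷ M ++ y ∷ R) ≡ L ++ y ∷ M ++ x ∷ R
swapVals-transpose {x = x} {y} L M R x↦y y↦x avL avM avR =
  trans (map-++ _ L (x ∷ M ++ y ∷ R))
  (cong₂ _++_ (swapVals-avoids L avL)
  (cong₂ _++_ x↦y
  (trans (map-++ _ M (y ∷ R))
  (cong₂ _++_ (swapVals-avoids M avM)
  (cong₂ _++_ y↦x (swapVals-avoids R avR))))))

swapVals-unique : ∀ {a b x y} L M R → a ≢ b → (x ≡ a × y ≡ b) ⊎ (x ≡ b × y ≡ a) →
  Unique (L ++ x ∷ M ++ y ∷ R) → swapVals a b (L ++ x ∷ M ++ y ∷ R) ≡ L ++ y ∷ M ++ x ∷ R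
swapVals-unique {a} {b} L M R a≢b (inj₁ (refl , refl)) u
  with unique-transposition L M R u
... | avL , avM , avR = swapVals-transpose L M R (swapVals-left a b) (swapVals-right a≢b) avL avM avR
swapVals-unique {a} {b} L M R a≢b (inj₂ (refl , refl)) u
  with unique-transposition L M R u
... | avL , avM , avR =
  swapVals-transpose L M R (swapVals-right a≢b) (swapVals-left a b) (swap avL) (swap avM) (swap avR)

transpose-↭ : ∀ (L : List ℕ) a M b R → L ++ a ∷ M ++ b ∷ R ↭ L ++ b ∷ M ++ a ∷ R
transpose-↭ L a M b R = ++⁺ˡ L (↭-trans (↭-prep a (shift b M R))
                                (↭-trans (↭-swap a b ↭-refl) (↭-prep b (↭-sym (shift a M R)))))

module _ {N : ℕ} {u : List ℕ} (u-perm : IsPerm N u) where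

  perm-unique : Unique u
  perm-unique = Unique-resp-↭ (↭⇒↭ₛ (↭-sym u-perm)) (map⁺ suc-injective (upTo⁺ N))

  perm-length : length u ≡ N
  perm-length = trans (↭-length u-perm) (trans (length-map suc (upTo N)) (length-upTo N))

  perm-∋ : ∀ {a} → 1 ≤ a → a ≤ N → a ∈ u
  perm-∋ {suc a} (s≤s z≤n) a≤N = ∈-resp-↭ (↭-sym u-perm) (∈-map⁺ suc (∈-upTo⁺ a≤N))

  perm-∈⇒≤ : ∀ {a} → a ∈ u → a ≤ N
  perm-∈⇒≤ a∈u with ∈-map⁻ suc (∈-resp-↭ u-perm a∈u)
  ... | _ , a′∈ , refl = ∈-upTo⁻ a′∈

  perm-< : All (_< suc N) u
  perm-< = All.tabulate (s≤s ∘ perm-∈⇒≤)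

  perm-snoc : IsPerm (suc N) (u ++ [ suc N ])
  perm-snoc = subst (λ xs → u ++ [ suc N ] ↭ map suc xs) (upTo-∷ʳ N)
    (subst (u ++ [ suc N ] ↭_) (sym (map-++ suc (upTo N) [ N ])) (++⁺ʳ [ suc N ] u-perm))

-- α ‼ m is the exponent of q_{m+1} in q^α, and 0 out of range.
infixl 9 _‼_
_‼_ : ∀ {n} → Vec ℕ n → ℕ → ℕ
[]       ‼ m     = 0
(x ∷ xs) ‼ zero  = x
(x ∷ xs) ‼ suc m = xs ‼ m

‼-· : ∀ {n} (α β : Vec ℕ n) m → (α · β) ‼ m ≡ α ‼ m + β ‼ m
‼-· []      []      m       = refl
‼-· (x ∷ α) (y ∷ β) zero    = refl
‼-· (x ∷ α) (y ∷ β) (suc m) = ‼-· α β m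

tabulate-‼ : ∀ n (f : ℕ → ℕ) {m} → m < n → tabulate {n = n} (f ∘ toℕ) ‼ m ≡ f m
tabulate-‼ (suc n) f {zero}  _         = refl
tabulate-‼ (suc n) f {suc m} (s≤s m<n) = tabulate-‼ n (f ∘ suc) m<n

tabulate-‼-zero : ∀ n (f : ℕ → ℕ) {m} → f m ≡ 0 → tabulate {n = n} (f ∘ toℕ) ‼ m ≡ 0
tabulate-‼-zero zero    f         _   = refl
tabulate-‼-zero (suc n) f {zero}  f≡0 = f≡0
tabulate-‼-zero (suc n) f {suc m} f≡0 = tabulate-‼-zero n (f ∘ suc) f≡0

zeros : (N : ℕ) → Mono N
zeros N = tabulate (λ _ → 0)

zeros-‼ : ∀ N m → zeros N ‼ m ≡ 0
zeros-‼ N m = tabulate-‼-zero (N ∸ 1) (λ _ → 0) refl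

qij-‼-inside : ∀ {N i j m} → i ≤ suc m → suc m < j → j ≤ N → qij N i j ‼ m ≡ 1
qij-‼-inside {zero}  _  <j j≤N = contradiction (<-≤-trans <j j≤N) n≮0
qij-‼-inside {suc N} {i} {j} {m} i≤ <j j≤N =
  trans (tabulate-‼ N (λ m → if (i ≤ᵇ suc m) ∧ (suc m <ᵇ j) then 1 else 0) m<N) entry
  where
  m<N : m < N
  m<N = ≤-pred (<-≤-trans <j j≤N)
  entry : (if (i ≤ᵇ suc m) ∧ (suc m <ᵇ j) then 1 else 0) ≡ 1
  entry rewrite Equivalence.to T-≡ (≤⇒≤ᵇ i≤) | Equivalence.to T-≡ (<⇒<ᵇ <j) = refl

qij-‼-outside : ∀ {N i j m} → suc m < i ⊎ j ≤ suc m → qij N i j ‼ m ≡ 0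
qij-‼-outside {N} {i} {j} {m} outside =
  tabulate-‼-zero (N ∸ 1) (λ m → if (i ≤ᵇ suc m) ∧ (suc m <ᵇ j) then 1 else 0) entry
  where
  entry : (if (i ≤ᵇ suc m) ∧ (suc m <ᵇ j) then 1 else 0) ≡ 0
  entry with (i ≤ᵇ suc m) ∧ (suc m <ᵇ j) in e
  ... | false = refl
  ... | true  = contradiction (Equivalence.to T-∧ (subst T (sym e) tt)) (excluded outside)
    where
    excluded : suc m < i ⊎ j ≤ suc m → ¬ (T (i ≤ᵇ suc m) × T (suc m <ᵇ j))
    excluded (inj₁ m<i) (i≤ , _)  = <⇒≱ m<i (≤ᵇ⇒≤ i (suc m) i≤)
    excluded (inj₂ j≤m) (_ , <j) = ≤⇒≯ j≤m (<ᵇ⇒< (suc m) j <j)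

-- Nonzero steps

ClassicalCover : ℕ → ℕ × ℕ → List ℕ → Set
ClassicalCover k (a , b) u =
  (minℕ (pos a u) (pos b u) ≤ k) × (k < maxℕ (pos a u) (pos b u)) × (ℓ (swapVals a b u) ≡ suc (ℓ u))

QuantumCover : ℕ → ℕ × ℕ → List ℕ → Set
QuantumCover k (a , b) u =
  (pos a u ≤ k) × (k < pos b u) × (ℓ (swapVals a b u) + 2 * (pos b u ∸ pos a u) ≡ suc (ℓ u))

act₁-just : ∀ {N k a b u β w} → act₁ N k (a , b) u ≡ just (β , w) →
  w ≡ swapVals a b u ×
  ((a < b × ClassicalCover k (a , b) u × β ≡ zeros N)
   ⊎ (¬ a < b × QuantumCover k (a , b) u × β ≡ qij N (pos a u) (pos b u)))
act₁-just {N} {k} {a} {b} {u} e with a <? b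
... | yes a<b with (minℕ (pos a u) (pos b u) ≤? k) ×-dec (k <? maxℕ (pos a u) (pos b u))
                   ×-dec (ℓ (swapVals a b u) ≟ suc (ℓ u))
...   | yes cov with e
...     | refl = refl , inj₁ (a<b , cov , refl)
act₁-just e | yes _ | no _ with e
... | ()
act₁-just {N} {k} {a} {b} {u} e | no a≮b
  with (pos a u ≤? k) ×-dec (k <? pos b u)
       ×-dec (ℓ (swapVals a b u) + 2 * (pos b u ∸ pos a u) ≟ suc (ℓ u))
... | yes cov with e
...   | refl = refl , inj₂ (a≮b , cov , refl)
act₁-just e | no _ | no _ with e
... | ()

act₁-classical : ∀ {N k a b u} → a < b → ClassicalCover k (a , b) u →
  act₁ N k (a , b) u ≡ just (zeros N , swapVals a b u)
act₁-classical {N} {k} {a} {b} {u} a<b cov with a <? b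
... | no a≮b = contradiction a<b a≮b
... | yes _ with (minℕ (pos a u) (pos b u) ≤? k) ×-dec (k <? maxℕ (pos a u) (pos b u))
                 ×-dec (ℓ (swapVals a b u) ≟ suc (ℓ u))
...   | yes _    = refl
...   | no ¬cov = contradiction cov ¬cov

act₁-quantum : ∀ {N k a b u} → ¬ a < b → QuantumCover k (a , b) u →
  act₁ N k (a , b) u ≡ just (qij N (pos a u) (pos b u) , swapVals a b u)
act₁-quantum {N} {k} {a} {b} {u} a≮b cov with a <? b
... | yes a<b = contradiction a<b a≮b
... | no _ with (pos a u ≤? k) ×-dec (k <? pos b u)
                ×-dec (ℓ (swapVals a b u) + 2 * (pos b u ∸ pos a u) ≟ suc (ℓ u))
...   | yes _    = refl
...   | no ¬cov = contradiction cov ¬cov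

record Cover (N a b : ℕ) (u : List ℕ) (β : Mono N) (w : List ℕ) : Set where
  field
    L M R     : List ℕ
    u≡        : u ≡ L ++ a ∷ M ++ b ∷ R
    w≡        : w ≡ L ++ b ∷ M ++ a ∷ R
    δ         : ℕ
    β-inside  : ∀ {m} → length L ≤ m → m ≤ length L + length M → β ‼ m ≡ δ
    β-outside : ∀ {m} → m < length L ⊎ length L + length M < m → β ‼ m ≡ 0
    shape     : (a < b × δ ≡ 0 × All (λ z → ¬ Between a b z) M)
              ⊎ (b < a × δ ≡ 1 × All (Between b a) M)

classical-cover : ∀ {N a b w} L M R → w ≡ L ++ b ∷ M ++ a ∷ R → a < b →
  let u = L ++ a ∷ M ++ b ∷ R in Unique u → ℓ w ≡ suc (ℓ u) → Cover N a b u (zeros N) w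
classical-cover {N} {a} {b} L M R refl a<b u-unique ℓ-up = record
  { L = L ; M = M ; R = R ; u≡ = refl ; w≡ = refl ; δ = 0
  ; β-inside = λ {m} _ _ → zeros-‼ N m
  ; β-outside = λ {m} _ → zeros-‼ N m
  ; shape = inj₁ (a<b , refl , count≡0⇒All∁ (between? a b) M none-between) }
  where
  none-between : count (between? a b) M ≡ 0
  none-between with middle-avoids L M R u-unique
  ... | a∉M , b∉M = ℓ-classical-cover L M R a<b a∉M b∉M ℓ-up

quantum-cover : ∀ {N a b w} L M R → w ≡ L ++ b ∷ M ++ a ∷ R → b < a →
  let u = L ++ a ∷ M ++ b ∷ R in Unique u → length u ≡ N →
  ℓ w + 2 * (pos b u ∸ pos a u) ≡ suc (ℓ u) → Cover N a b u (qij N (pos a u) (pos b u)) w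
quantum-cover {N} {a} {b} L M R refl b<a u-unique u-length ℓ-eq = record
  { L = L ; M = M ; R = R ; u≡ = refl ; w≡ = refl ; δ = 1
  ; β-inside = β-inside
  ; β-outside = β-outside
  ; shape = inj₂ (b<a , refl , count≡length⇒All (between? b a) M all-between) }
  where
  u = L ++ a ∷ M ++ b ∷ R
  pa : pos a u ≡ suc (length L)
  pa = pos-first L M R u-unique
  pb : pos b u ≡ suc (length L + suc (length M))
  pb = pos-second L M R u-unique
  pb≤N : pos b u ≤ N
  pb≤N with pos-∈ u (∈-++⁺ʳ L (there (∈-++⁺ʳ M (here refl))))
  ... | p , pos≡ , p<len = subst₂ _≤_ (sym pos≡) u-length p<len
  β-inside : ∀ {m} → length L ≤ m → m ≤ length L + length M → qij N (pos a u) (pos b u) ‼ m ≡ 1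
  β-inside {m} L≤m m≤LM = qij-‼-inside (subst (_≤ suc m) (sym pa) (s≤s L≤m))
    (subst (suc m <_) (sym pb) (s≤s (subst (suc m ≤_) (sym (+-suc (length L) (length M))) (s≤s m≤LM))))
    pb≤N
  β-outside : ∀ {m} → m < length L ⊎ length L + length M < m → qij N (pos a u) (pos b u) ‼ m ≡ 0
  β-outside {m} (inj₁ m<L)  = qij-‼-outside {N} {pos a u} {pos b u}
    (inj₁ (subst (suc m <_) (sym pa) (s≤s m<L)))
  β-outside {m} (inj₂ LM<m) = qij-‼-outside {N} {pos a u} {pos b u}
    (inj₂ (subst (_≤ suc m) (sym pb) (s≤s (subst (_≤ m) (sym (+-suc (length L) (length M))) LM<m))))
  gap : pos b u ∸ pos a u ≡ suc (length M)
  gap = trans (cong₂ _∸_ pb pa) (m+n∸m≡n (length L) (suc (length M)))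
  all-between : count (between? b a) M ≡ length M
  all-between with middle-avoids L M R u-unique
  ... | a∉M , b∉M = ℓ-quantum-cover L M R b<a a∉M b∉M
    (subst (λ g → ℓ (L ++ b ∷ M ++ a ∷ R) + 2 * g ≡ suc (ℓ u)) gap ℓ-eq)

-- Both kinds of step need a to precede b: otherwise the swap lowers ℓ,
-- resp. pos a ≤ k < pos b fails.
act₁-cover : ∀ {N k a b u β w} → IsPerm N u → ValidOp (a , b) → a ≤ N → b ≤ N →
  act₁ N k (a , b) u ≡ just (β , w) → Cover N a b u β w
act₁-cover {N} {k} {a} {b} {u} P (1≤a , 1≤b , a≢b) a≤N b≤N e
  with act₁-just {N} {k} {a} {b} {u} e | precedes-or-follows (perm-∋ P 1≤a a≤N) (perm-∋ P 1≤b b≤N) a≢b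
... | refl , inj₁ (a<b , (_ , _ , ℓ-up) , refl) | inj₁ (precedes L M R) =
  classical-cover L M R (swapVals-unique L M R a≢b (inj₁ (refl , refl)) (perm-unique P)) a<b (perm-unique P) ℓ-up
... | refl , inj₁ (a<b , (_ , _ , ℓ-up) , refl) | inj₂ (precedes L M R)
  with middle-avoids L M R (perm-unique P)
...   | b∉M , a∉M = contradiction (trans (ℓ-transpose a<b L M R a∉M b∉M) (cong (_+ _) ℓ-down)) (m≢1+m+n _)
  where
  ℓ-down : ℓ (L ++ a ∷ M ++ b ∷ R) ≡ suc (ℓ (L ++ b ∷ M ++ a ∷ R))
  ℓ-down = subst (λ w → ℓ w ≡ suc (ℓ (L ++ b ∷ M ++ a ∷ R)))
                 (swapVals-unique L M R a≢b (inj₂ (refl , refl)) (perm-unique P)) ℓ-up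
act₁-cover {N} {k} {a} {b} {u} P (1≤a , 1≤b , a≢b) a≤N b≤N e
  | refl , inj₂ (a≮b , (_ , _ , ℓ-eq) , refl) | inj₁ (precedes L M R) =
  quantum-cover L M R (swapVals-unique L M R a≢b (inj₁ (refl , refl)) (perm-unique P))
    (≤∧≢⇒< (≮⇒≥ a≮b) (a≢b ∘ sym)) (perm-unique P) (perm-length P) ℓ-eq
act₁-cover {N} {k} {a} {b} {u} P (1≤a , 1≤b , a≢b) a≤N b≤N e
  | refl , inj₂ (_ , (pa≤k , k<pb , _) , refl) | inj₂ (precedes L M R) =
  contradiction (≤-<-trans pa≤k k<pb)
    (≤⇒≯ (subst₂ _≤_ (sym (pos-first L M R (perm-unique P))) (sym (pos-second L M R (perm-unique P)))
                     (s≤s (m≤m+n _ _))))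

-- Ranks

take-++-≤ : ∀ {n} (X Y : List ℕ) → n ≤ length X → take n (X ++ Y) ≡ take n X
take-++-≤ {zero}  X       Y _         = refl
take-++-≤ {suc n} (x ∷ X) Y (s≤s n≤X) = cong (x ∷_) (take-++-≤ X Y n≤X)

take-++-+ : ∀ (X Y : List ℕ) n → take (length X + n) (X ++ Y) ≡ X ++ take n Y
take-++-+ []      Y n = refl
take-++-+ (x ∷ X) Y n = cong (x ∷_) (take-++-+ X Y n)

take-into : ∀ (L : List ℕ) x M Y {p} → p ≤ length M →
  take (length L + suc p) (L ++ x ∷ M ++ Y) ≡ L ++ x ∷ take p M
take-into L x M Y p≤M = trans (take-++-+ L (x ∷ M ++ Y) _) (cong (λ P → L ++ x ∷ P) (take-++-≤ M Y p≤M))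

take-past : ∀ (L : List ℕ) x M y R q →
  take (length L + suc (length M + suc q)) (L ++ x ∷ M ++ y ∷ R) ≡ L ++ x ∷ M ++ y ∷ take q R
take-past L x M y R q =
  trans (take-++-+ L (x ∷ M ++ y ∷ R) _) (cong (λ P → L ++ x ∷ P) (take-++-+ M (y ∷ R) (suc q)))

atLeast : ℕ → List ℕ → ℕ
atLeast t = count (t ≤?_)

atLeast-mono : ∀ t {x y} → x ≤ y → atLeast t [ x ] ≤ atLeast t [ y ]
atLeast-mono t {x} {y} x≤y = by-cases (t ≤? x)
  where
  by-cases : Dec (t ≤ x) → atLeast t [ x ] ≤ atLeast t [ y ]
  by-cases (yes t≤x) =
    ≤-reflexive (trans (count-yes (t ≤?_) t≤x) (sym (count-yes (t ≤?_) (≤-trans t≤x x≤y))))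
  by-cases (no  t≰x) = subst (_≤ _) (sym (count-no (t ≤?_) t≰x)) z≤n

atLeast-agree : ∀ t {x y} → (t ≤ x → t ≤ y) → (t ≤ y → t ≤ x) →
  atLeast t [ x ] ≡ atLeast t [ y ]
atLeast-agree t {x} {y} to from = by-cases (t ≤? x)
  where
  by-cases : Dec (t ≤ x) → atLeast t [ x ] ≡ atLeast t [ y ]
  by-cases (yes t≤x) = trans (count-yes (t ≤?_) t≤x) (sym (count-yes (t ≤?_) (to t≤x)))
  by-cases (no  t≰x) = trans (count-no (t ≤?_) t≰x) (sym (count-no (t ≤?_) (t≰x ∘ from)))

-- Cut m lies between positions m+1 and m+2, where q_{m+1} sits.
rank : ∀ {n} → ℕ → ℕ → Vec ℕ n × List ℕ → ℕ
rank t m (α , w) = atLeast t (take (suc m) w) + α ‼ m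

-- For c at 0-based index i, the cuts i and pred i lie just after and just before c; pred 0 is a
-- junk cut, which the arguments below tolerate.
Φ : ∀ {n} → ℕ → ℕ → Vec ℕ n × List ℕ → ℕ
Φ c i y = rank (suc c) i y + rank c (pred i) y

module _ {a b : ℕ} (L M R : List ℕ) where

  private
    u = L ++ a ∷ M ++ b ∷ R
    w = L ++ b ∷ M ++ a ∷ R

  prefix-before : ∀ {m} → m < length L → take (suc m) w ≡ take (suc m) u
  prefix-before m<L = trans (take-++-≤ L (b ∷ M ++ a ∷ R) m<L) (sym (take-++-≤ L (a ∷ M ++ b ∷ R) m<L))

  prefix-inside : ∀ {m} → length L ≤ m → m ≤ length L + length M →
    ∃ λ P → take (suc m) u ≡ L ++ a ∷ P × take (suc m) w ≡ L ++ b ∷ P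
  prefix-inside L≤m m≤LM with m≤n⇒∃[o]m+o≡n L≤m
  ... | p , refl = take p M , prefix a (b ∷ R) , prefix b (a ∷ R)
    where
    p≤M : p ≤ length M
    p≤M = +-cancelˡ-≤ (length L) p (length M) m≤LM
    prefix : ∀ x Y → take (suc (length L + p)) (L ++ x ∷ M ++ Y) ≡ L ++ x ∷ take p M
    prefix x Y = trans (cong (λ n → take n (L ++ x ∷ M ++ Y)) (sym (+-suc (length L) p)))
                       (take-into L x M Y p≤M)

  prefix-after : ∀ {m} → length L + length M < m → take (suc m) w ↭ take (suc m) u
  prefix-after LM<m with m≤n⇒∃[o]m+o≡n LM<m
  ... | q , refl = subst₂ _↭_ (sym (prefix b a)) (sym (prefix a b)) (↭-sym (transpose-↭ L a M b (take q R)))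
    where
    prefix : ∀ x y →
      take (suc (suc (length L + length M) + q)) (L ++ x ∷ M ++ y ∷ R) ≡ L ++ x ∷ M ++ y ∷ take q R
    prefix x y = trans (cong (λ n → take n (L ++ x ∷ M ++ y ∷ R)) (arrange (length L) (length M) q))
                       (take-past L x M y R q)
      where
      arrange : ∀ l m q → suc (suc (l + m) + q) ≡ l + suc (m + suc q)
      arrange = solve-∀

module _ {N a b u β w} (cov : Cover N a b u β w) where
  open Cover cov

  rank-outside : ∀ t {m} (α : Mono N) → m < length L ⊎ length L + length M < m →
    rank t m (α · β , w) ≡ rank t m (α , u)
  rank-outside t {m} α outside rewrite u≡ | w≡ = cong₂ _+_ (prefixes outside) exponent
    where
    prefixes : m < length L ⊎ length L + length M < m →
      atLeast t (take (suc m) (L ++ b ∷ M ++ a ∷ R)) ≡ atLeast t (take (suc m) (L ++ a ∷ M ++ b ∷ R))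
    prefixes (inj₁ m<L)  = cong (atLeast t) (prefix-before L M R m<L)
    prefixes (inj₂ LM<m) = count-↭ (t ≤?_) (prefix-after L M R LM<m)
    exponent : (α · β) ‼ m ≡ α ‼ m
    exponent = trans (‼-· α β m) (trans (cong (α ‼ m +_) (β-outside outside)) (+-identityʳ _))

  rank-inside : ∀ t {m} (α : Mono N) → length L ≤ m → m ≤ length L + length M →
    rank t m (α · β , w) + atLeast t [ a ] ≡ rank t m (α , u) + atLeast t [ b ] + δ
  rank-inside t {m} α L≤m m≤LM rewrite u≡ | w≡ with prefix-inside {a} {b} L M R L≤m m≤LM
  ... | P , u-prefix , w-prefix rewrite u-prefix | w-prefix
                                      | count-++ (t ≤?_) L (a ∷ P) | count-++ (t ≤?_) L (b ∷ P)
                                      | count-∷ (t ≤?_) a P | count-∷ (t ≤?_) b P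
                                      | ‼-· α β m | β-inside L≤m m≤LM =
    rearrange (atLeast t L) (atLeast t [ a ]) (atLeast t [ b ]) (atLeast t P) (α ‼ m) δ
    where
    rearrange : ∀ l x y p e d → l + (y + p) + (e + d) + x ≡ l + (x + p) + e + y + d
    rearrange = solve-∀

  region : ∀ m → (m < length L ⊎ length L + length M < m) ⊎ (length L ≤ m × m ≤ length L + length M)
  region m with m <? length L | length L + length M <? m
  ... | yes m<L | _         = inj₁ (inj₁ m<L)
  ... | no _    | yes LM<m  = inj₁ (inj₂ LM<m)
  ... | no m≮L  | no LM≮m   = inj₂ (≮⇒≥ m≮L , ≮⇒≥ LM≮m)

  balance-≤ : ∀ t → atLeast t [ a ] ≤ atLeast t [ b ] + δ
  balance-≤ t with shape
  ... | inj₁ (a<b , refl , _) = ≤-trans (atLeast-mono t (<⇒≤ a<b)) (≤-reflexive (sym (+-identityʳ _)))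
  ... | inj₂ (_ , refl , _)   = ≤-trans (count-≤1 (t ≤?_) a) (m≤n+m 1 _)

  rank-mono : ∀ t m (α : Mono N) → rank t m (α , u) ≤ rank t m (α · β , w)
  rank-mono t m α with region m
  ... | inj₁ outside          = ≤-reflexive (sym (rank-outside t α outside))
  ... | inj₂ (L≤m , m≤LM) = +-cancelʳ-≤ (atLeast t [ a ]) _ _ (begin
      rank t m (α , u) + atLeast t [ a ]          ≤⟨ +-monoʳ-≤ (rank t m (α , u)) (balance-≤ t) ⟩
      rank t m (α , u) + (atLeast t [ b ] + δ)    ≡⟨ sym (+-assoc (rank t m (α , u)) _ δ) ⟩
      rank t m (α , u) + atLeast t [ b ] + δ      ≡⟨ sym (rank-inside t α L≤m m≤LM) ⟩
      rank t m (α · β , w) + atLeast t [ a ]      ∎)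
    where open ≤-Reasoning

  rank-inside-< : ∀ t {m} (α : Mono N) → length L ≤ m → m ≤ length L + length M →
    atLeast t [ a ] < atLeast t [ b ] + δ → rank t m (α , u) < rank t m (α · β , w)
  rank-inside-< t {m} α L≤m m≤LM imbalance = +-cancelʳ-< (atLeast t [ a ]) _ _ (begin-strict
      rank t m (α , u) + atLeast t [ a ]          <⟨ +-monoʳ-< (rank t m (α , u)) imbalance ⟩
      rank t m (α , u) + (atLeast t [ b ] + δ)    ≡⟨ sym (+-assoc (rank t m (α , u)) _ δ) ⟩
      rank t m (α , u) + atLeast t [ b ] + δ      ≡⟨ sym (rank-inside t α L≤m m≤LM) ⟩
      rank t m (α · β , w) + atLeast t [ a ]      ∎)
    where open ≤-Reasoning

  rank-inside-≡ : ∀ t {m} (α : Mono N) → length L ≤ m → m ≤ length L + length M →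
    atLeast t [ a ] ≡ atLeast t [ b ] + δ → rank t m (α · β , w) ≡ rank t m (α , u)
  rank-inside-≡ t {m} α L≤m m≤LM balance = +-cancelʳ-≡ (atLeast t [ a ]) _ _ (begin
      rank t m (α · β , w) + atLeast t [ a ]      ≡⟨ rank-inside t α L≤m m≤LM ⟩
      rank t m (α , u) + atLeast t [ b ] + δ      ≡⟨ +-assoc (rank t m (α , u)) _ δ ⟩
      rank t m (α , u) + (atLeast t [ b ] + δ)    ≡⟨ cong (rank t m (α , u) +_) (sym balance) ⟩
      rank t m (α , u) + atLeast t [ a ]          ∎)
    where open ≡-Reasoning

  Φ-mono : ∀ c i (α : Mono N) → Φ c i (α , u) ≤ Φ c i (α · β , w)
  Φ-mono c i α = +-mono-≤ (rank-mono (suc c) i α) (rank-mono c (pred i) α)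

  Φ-first-< : Unique u → ∀ (α : Mono N) →
    Φ a (pred (pos a u)) (α , u) < Φ a (pred (pos a u)) (α · β , w)
  Φ-first-< u-unique α rewrite trans (cong (pos a) u≡) (pos-first L M R (subst Unique u≡ u-unique)) =
    +-mono-<-≤ (rank-inside-< (suc a) α ≤-refl (m≤m+n _ _) imbalance) (rank-mono a (pred (length L)) α)
    where
    imbalance : atLeast (suc a) [ a ] < atLeast (suc a) [ b ] + δ
    imbalance rewrite count-no (suc a ≤?_) (n≮n a) with shape
    ... | inj₁ (a<b , refl , _) rewrite count-yes (suc a ≤?_) a<b = s≤s z≤n
    ... | inj₂ (_ , refl , _)   = m≤n+m 1 _

  Φ-second-< : Unique u → ∀ (α : Mono N) →
    Φ b (pred (pos b u)) (α , u) < Φ b (pred (pos b u)) (α · β , w)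
  Φ-second-< u-unique α rewrite trans (cong (pos b) u≡) (pos-second L M R (subst Unique u≡ u-unique))
                             | +-suc (length L) (length M) =
    +-mono-≤-< (rank-mono (suc b) (suc (length L + length M)) α)
               (rank-inside-< b α (m≤m+n _ _) ≤-refl imbalance)
    where
    imbalance : atLeast b [ a ] < atLeast b [ b ] + δ
    imbalance rewrite count-yes (b ≤?_) (≤-refl {b}) with shape
    ... | inj₁ (a<b , refl , _) rewrite count-no (b ≤?_) (<⇒≱ a<b) = s≤s z≤n
    ... | inj₂ (_ , refl , _)   = s≤s (count-≤1 (b ≤?_) a)

  balance-between : ∀ {c} → c ∈ M → a ≢ c → b ≢ c →
    (atLeast (suc c) [ a ] ≡ atLeast (suc c) [ b ] + δ) × (atLeast c [ a ] ≡ atLeast c [ b ] + δ)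
  balance-between {c} c∈M a≢c b≢c with shape
  ... | inj₁ (a<b , refl , none-between) =
    trans (atLeast-agree (suc c) (λ c<a → <-trans c<a a<b)
                                 (λ c<b → ≤∧≢⇒< (c≤a c<b) (a≢c ∘ sym)))
          (sym (+-identityʳ _)) ,
    trans (atLeast-agree c (λ c≤a → ≤-trans c≤a (<⇒≤ a<b))
                           (λ c≤b → c≤a (≤∧≢⇒< c≤b (b≢c ∘ sym))))
          (sym (+-identityʳ _))
    where
    c≤a : c < b → c ≤ a
    c≤a c<b = ≮⇒≥ (λ a<c → All.lookup none-between c∈M (a<c , c<b))
  ... | inj₂ (_ , refl , all-between) with All.lookup all-between c∈M
  ...   | b<c , c<a =
    trans (count-yes (suc c ≤?_) c<a) (cong (_+ 1) (sym (count-no (suc c ≤?_) (<⇒≯ b<c)))) ,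
    trans (count-yes (c ≤?_) (<⇒≤ c<a)) (cong (_+ 1) (sym (count-no (c ≤?_) (<⇒≱ b<c))))

  Φ-fixed : ∀ {c} → c ∈ u → a ≢ c → b ≢ c → ∀ (α : Mono N) →
    Φ c (pred (pos c u)) (α · β , w) ≡ Φ c (pred (pos c u)) (α , u)
  Φ-fixed {c} c∈u a≢c b≢c α with pos-by-segment L M R (subst (c ∈_) u≡ c∈u) a≢c b≢c
  ... | inj₁ (p , pos≡ , p<L) rewrite trans (cong (pos c) u≡) pos≡ =
    cong₂ _+_ (rank-outside (suc c) α (inj₁ p<L)) (rank-outside c α (inj₁ (≤-<-trans pred[n]≤n p<L)))
  ... | inj₂ (inj₁ (c∈M , p , pos≡ , p<M)) rewrite trans (cong (pos c) u≡) pos≡ =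
    cong₂ _+_ (rank-inside-≡ (suc c) α (m≤n⇒m≤1+n (m≤m+n _ p))
                             (subst (_≤ length L + length M) (+-suc (length L) p) (+-monoʳ-≤ (length L) p<M))
                             (proj₁ (balance-between c∈M a≢c b≢c)))
              (rank-inside-≡ c α (m≤m+n _ p) (+-monoʳ-≤ (length L) (<⇒≤ p<M))
                             (proj₂ (balance-between c∈M a≢c b≢c)))
  ... | inj₂ (inj₂ (p , pos≡)) rewrite trans (cong (pos c) u≡) pos≡ =
    cong₂ _+_ (rank-outside (suc c) α (inj₂ (m<n⇒m<1+n (s≤s (m≤m+n _ p)))))
              (rank-outside c α (inj₂ (s≤s (m≤m+n _ p))))

  pos-fixed : ∀ {c} → a ≢ c → b ≢ c → pos c w ≡ pos c u
  pos-fixed {c} a≢c b≢c =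
    trans (cong (pos c) w≡) (trans (sym (pos-transpose L M R a≢c b≢c)) (cong (pos c) (sym u≡)))

  cover-perm : IsPerm N u → IsPerm N w
  cover-perm u-perm =
    subst (_↭ _) (sym w≡) (↭-trans (↭-sym (transpose-↭ L a M b R)) (subst (_↭ _) u≡ u-perm))

-- Runs

act-∷-just : ∀ {N k y} o os x → act N k (o ∷ os) x ≡ just y →
  ∃ λ z → act N k os x ≡ just z × actElt N k o z ≡ just y
act-∷-just {N} {k} o os x e with act N k os x
... | just z = z , refl , e

actElt-just : ∀ {N k y} o α u → actElt N k o (α , u) ≡ just y →
  ∃₂ λ β w → act₁ N k o u ≡ just (β , w) × y ≡ (α · β , w)
actElt-just {N} {k} o α u e with act₁ N k o u
actElt-just o α u refl | just (β , w) = β , w , refl , refl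

actElt-of : ∀ {N k α β w} o u → act₁ N k o u ≡ just (β , w) →
  actElt N k o (α , u) ≡ just (α · β , w)
actElt-of o u e rewrite e = refl

SuppIn-head : ∀ {N a b} os → SuppIn N ((a , b) ∷ os) → (a ≤ N) × (b ≤ N)
SuppIn-head os s = proj₂ (s _ (here refl)) , proj₂ (s _ (there (here refl)))

SuppIn-tail : ∀ {N o} os → SuppIn N (o ∷ os) → SuppIn N os
SuppIn-tail os s x x∈ = s x (there (there x∈))

SuppIn-mono : ∀ {N N′} W → N ≤ N′ → SuppIn N W → SuppIn N′ W
SuppIn-mono W N≤N′ s x x∈ = proj₁ (s x x∈) , ≤-trans (proj₂ (s x x∈)) N≤N′

run-perm : ∀ {N k u α y} W → All ValidOp W → SuppIn N W → IsPerm N u →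
  act N k W (α , u) ≡ just y → IsPerm N (proj₂ y)
run-perm [] _ _ u-perm refl = u-perm
run-perm {u = u} {α} ((a , b) ∷ os) (valid ∷ valids) s u-perm e with act-∷-just (a , b) os (α , u) e
... | (α₁ , u₁) , run , step with actElt-just (a , b) α₁ u₁ step | SuppIn-head os s
...   | β , w , step₁ , refl | a≤N , b≤N = cover-perm (act₁-cover u₁-perm valid a≤N b≤N step₁) u₁-perm
  where
  u₁-perm = run-perm os valids (SuppIn-tail os s) u-perm run

record LastStep (N k a b : ℕ) (os : Word) (x y : Elt N) : Set where
  field
    α₁      : Mono N
    u₁      : List ℕ
    β       : Mono N
    w       : List ℕ
    run     : act N k os x ≡ just (α₁ , u₁)
    u₁-perm : IsPerm N u₁
    step    : act₁ N k (a , b) u₁ ≡ just (β , w)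
    y≡      : y ≡ (α₁ · β , w)
    cover   : Cover N a b u₁ β w

last-step : ∀ {N k a b os u α y} → All ValidOp ((a , b) ∷ os) → SuppIn N ((a , b) ∷ os) → IsPerm N u →
  act N k ((a , b) ∷ os) (α , u) ≡ just y → LastStep N k a b os (α , u) y
last-step {a = a} {b} {os} {u} {α} (valid ∷ valids) s u-perm e with act-∷-just (a , b) os (α , u) e
... | (α₁ , u₁) , run , step with actElt-just (a , b) α₁ u₁ step | SuppIn-head os s
...   | β , w , step₁ , y≡ | a≤N , b≤N = record
  { α₁ = α₁ ; u₁ = u₁ ; β = β ; w = w ; run = run ; u₁-perm = u₁-perm ; step = step₁ ; y≡ = y≡
  ; cover = act₁-cover u₁-perm valid a≤N b≤N step₁ }
  where
  u₁-perm = run-perm os valids (SuppIn-tail os s) u-perm run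

run-avoiding : ∀ {N k c u α α′ u′} W → All ValidOp W → SuppIn N W → IsPerm N u →
  act N k W (α , u) ≡ just (α′ , u′) → c ∉ supp W → 1 ≤ c → c ≤ N →
  pos c u′ ≡ pos c u × Φ c (pred (pos c u)) (α′ , u′) ≡ Φ c (pred (pos c u)) (α , u)
run-avoiding [] _ _ _ refl _ _ _ = refl , refl
run-avoiding {c = c} ((a , b) ∷ os) valids s u-perm e c∉ 1≤c c≤N with last-step valids s u-perm e
... | record { α₁ = α₁ ; u₁ = u₁ ; β = β ; w = w ; run = run ; u₁-perm = u₁-perm ; y≡ = refl ; cover = cov }
  with run-avoiding os (All.tail valids) (SuppIn-tail os s) u-perm run (c∉ ∘ there ∘ there) 1≤c c≤N
...   | pos-kept , Φ-kept =
  trans (pos-fixed cov a≢c b≢c) pos-kept ,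
  trans (subst (λ p → Φ c (pred p) (α₁ · β , w) ≡ Φ c (pred p) (α₁ , u₁)) pos-kept
               (Φ-fixed cov (perm-∋ u₁-perm 1≤c c≤N) a≢c b≢c α₁))
        Φ-kept
  where
  a≢c : a ≢ c
  a≢c a≡c = c∉ (here (sym a≡c))
  b≢c : b ≢ c
  b≢c b≡c = c∉ (there (here (sym b≡c)))

run-touching : ∀ {N k c u α y} W → All ValidOp W → SuppIn N W → IsPerm N u →
  act N k W (α , u) ≡ just y → c ∈ supp W → c ≤ N →
  Φ c (pred (pos c u)) (α , u) < Φ c (pred (pos c u)) y
run-touching {c = c} ((a , b) ∷ os) valids s u-perm e c∈ c≤N with last-step valids s u-perm e
... | record { α₁ = α₁ ; u₁ = u₁ ; β = β ; w = w ; run = run ; u₁-perm = u₁-perm ; y≡ = refl ; cover = cov }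
  with c ∈? supp os
...   | yes c∈os =
  <-≤-trans (run-touching os (All.tail valids) (SuppIn-tail os s) u-perm run c∈os c≤N) (Φ-mono cov c _ α₁)
...   | no c∉os with run-avoiding os (All.tail valids) (SuppIn-tail os s) u-perm run c∉os (proj₁ (s c c∈)) c≤N
...     | pos-kept , Φ-kept =
  ≤-trans (≤-reflexive (cong suc (sym Φ-kept)))
          (subst (λ p → Φ c (pred p) (α₁ , u₁) < Φ c (pred p) (α₁ · β , w)) pos-kept (moved c∈))
  where
  moved : c ∈ supp ((a , b) ∷ os) → Φ c (pred (pos c u₁)) (α₁ , u₁) < Φ c (pred (pos c u₁)) (α₁ · β , w)
  moved (here refl)          = Φ-first-< cov (perm-unique u₁-perm) α₁
  moved (there (here refl))  = Φ-second-< cov (perm-unique u₁-perm) α₁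
  moved (there (there c∈os)) = contradiction c∈os c∉os

common-run⇒supp-⊆ : ∀ {N k u α y c} W₁ W₂ → All ValidOp W₁ → All ValidOp W₂ →
  SuppIn N W₁ → SuppIn N W₂ → IsPerm N u →
  act N k W₁ (α , u) ≡ just y → act N k W₂ (α , u) ≡ just y → c ∈ supp W₁ → c ∈ supp W₂
common-run⇒supp-⊆ {c = c} W₁ W₂ valids₁ valids₂ s₁ s₂ u-perm run₁ run₂ c∈₁ with c ∈? supp W₂
... | yes c∈₂ = c∈₂
... | no  c∉₂ = ⊥-elim (<-irrefl (sym (proj₂ (run-avoiding W₂ valids₂ s₂ u-perm run₂ c∉₂ 1≤c c≤N)))
                                (run-touching W₁ valids₁ s₁ u-perm run₁ c∈₁ c≤N))
  where
  1≤c = proj₁ (s₁ c c∈₁)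
  c≤N = proj₂ (s₁ c c∈₁)

-- Enlarging N

swapVals-snoc : ∀ {a b y} u → a < y → b < y → swapVals a b (u ++ [ y ]) ≡ swapVals a b u ++ [ y ]
swapVals-snoc {a} {b} {y} u a<y b<y =
  trans (map-++ _ u [ y ]) (cong (swapVals a b u ++_) (swapVals-avoids [ y ] (≢-last a<y , ≢-last b<y)))
  where
  ≢-last : ∀ {x} → x < y → x ∉ [ y ]
  ≢-last x<y (here x≡y) = <-irrefl x≡y x<y

-- A new largest entry at the end changes neither positions nor inversion numbers, so a run
-- survives enlarging N; this matters because v ≣ v′ only speaks about N ⊇ supp v ∪ supp v′.
act₁-snoc : ∀ {N N′ k a b u β w y} → a ∈ u → b ∈ u → a < y → b < y → All (_< y) u → All (_< y) w →
  act₁ N k (a , b) u ≡ just (β , w) →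
  ∃ λ β′ → act₁ N′ k (a , b) (u ++ [ y ]) ≡ just (β′ , w ++ [ y ])
act₁-snoc {N} {N′} {k} {a} {b} {u} {y = y} a∈u b∈u a<y b<y u<y w<y e with act₁-just {N} {k} {a} {b} {u} e
... | refl , inj₁ (a<b , cover , refl) =
  zeros N′ , trans (act₁-classical a<b cover′) (cong (λ v → just (zeros N′ , v)) (swapVals-snoc u a<y b<y))
  where
  cover′ : ClassicalCover k (a , b) (u ++ [ y ])
  cover′ rewrite pos-++-∈ u [ y ] a∈u | pos-++-∈ u [ y ] b∈u | swapVals-snoc u a<y b<y
               | ℓ-snoc-max u u<y | ℓ-snoc-max (swapVals a b u) w<y = cover
... | refl , inj₂ (a≮b , cover , refl) =
  qij N′ i j , trans (act₁-quantum a≮b cover′) (cong (λ v → just (qij N′ i j , v)) (swapVals-snoc u a<y b<y))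
  where
  i = pos a (u ++ [ y ])
  j = pos b (u ++ [ y ])
  cover′ : QuantumCover k (a , b) (u ++ [ y ])
  cover′ rewrite pos-++-∈ u [ y ] a∈u | pos-++-∈ u [ y ] b∈u | swapVals-snoc u a<y b<y
               | ℓ-snoc-max u u<y | ℓ-snoc-max (swapVals a b u) w<y = cover

act-snoc : ∀ {N k u α α′ u′} W → All ValidOp W → SuppIn N W → IsPerm N u →
  act N k W (α , u) ≡ just (α′ , u′) → ∀ {N′} (α₂ : Mono N′) →
  ∃ λ β₂ → act N′ k W (α₂ , u ++ [ suc N ]) ≡ just (β₂ , u′ ++ [ suc N ])
act-snoc [] _ _ _ refl α₂ = α₂ , refl
act-snoc {N} {k} ((a , b) ∷ os) valids@((1≤a , 1≤b , _) ∷ _) s u-perm e {N′} α₂ with last-step valids s u-perm e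
... | record { u₁ = u₁ ; run = run ; u₁-perm = u₁-perm ; step = step ; y≡ = refl ; cover = cov }
  with SuppIn-head os s
...   | a≤N , b≤N with act-snoc os (All.tail valids) (SuppIn-tail os s) u-perm run α₂
                     | act₁-snoc {N′ = N′} (perm-∋ u₁-perm 1≤a a≤N) (perm-∋ u₁-perm 1≤b b≤N) (s≤s a≤N) (s≤s b≤N)
                                 (perm-< u₁-perm) (perm-< (cover-perm cov u₁-perm)) step
...     | β₁ , run₂ | β′ , step₂ =
  β₁ · β′ , trans (cong (_>>= actElt N′ k (a , b)) run₂) (actElt-of (a , b) (u₁ ++ [ suc N ]) step₂)

lift-run : ∀ d {N k u α y} W → All ValidOp W → SuppIn N W → IsPerm N u → act N k W (α , u) ≡ just y →
  ∃ λ u₂ → ∃ λ (α₂ : Mono (d + N)) → ∃ λ y₂ → IsPerm (d + N) u₂ × act (d + N) k W (α₂ , u₂) ≡ just y₂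
lift-run zero    {u = u} {α} {y} W _ _ u-perm run = u , α , y , u-perm , run
lift-run (suc d) {N} W valids s u-perm run with lift-run d W valids s u-perm run
... | u₂ , α₂ , (β₂ , w₂) , u₂-perm , run₂
  with act-snoc W valids (SuppIn-mono W (m≤n+m N d) s) u₂-perm run₂ (zeros (suc (d + N)))
...   | β₃ , run₃ =
  u₂ ++ [ suc (d + N) ] , zeros (suc (d + N)) , (β₃ , w₂ ++ [ suc (d + N) ]) , perm-snoc u₂-perm , run₃

∈⇒≤sum : ∀ {x xs} → x ∈ xs → x ≤ sum xs
∈⇒≤sum {xs = y ∷ ys} (here refl)  = m≤m+n y (sum ys)
∈⇒≤sum {xs = y ∷ ys} (there x∈ys) = ≤-trans (∈⇒≤sum x∈ys) (m≤n+m (sum ys) y)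

supp-positive : ∀ {x} W → All ValidOp W → x ∈ supp W → 1 ≤ x
supp-positive ((a , b) ∷ _) ((1≤a , _ , _) ∷ _) (here refl)         = 1≤a
supp-positive ((a , b) ∷ _) ((_ , 1≤b , _) ∷ _) (there (here refl)) = 1≤b
supp-positive (_ ∷ W) (_ ∷ valids) (there (there x∈W))           = supp-positive W valids x∈W

-- ¬ IsZero v yields no run constructively, so the conclusion is restricted to decidable P.
common-run-elim : ∀ {v v′} → All ValidOp v → All ValidOp v′ → v ≣ v′ → ¬ IsZero v →
  ∀ {P : Set} → Dec P →
  (∀ {N k u α y} → SuppIn N v → SuppIn N v′ → IsPerm N u →
     act N k v (α , u) ≡ just y → act N k v′ (α , u) ≡ just y → P) → P
common-run-elim {v} {v′} valid valid′ v≣v′ v≢0 {P} P? from-run = decidable-stable P? (v≢0 ∘ vanishes)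
  where
  d = sum (supp v′)
  vanishes : ¬ P → IsZero v
  vanishes ¬P N s k 1≤k k<N α u u-perm with act N k v (α , u) in run
  ... | nothing = refl
  ... | just y with lift-run d v valid s u-perm run
  ...   | u₂ , α₂ , y₂ , u₂-perm , run₂ = ⊥-elim (¬P (from-run s₂ s₂′ u₂-perm run₂ run₂′))
    where
    s₂ : SuppIn (d + N) v
    s₂ = SuppIn-mono v (m≤n+m N d) s
    s₂′ : SuppIn (d + N) v′
    s₂′ x x∈ = supp-positive v′ valid′ x∈ , ≤-trans (∈⇒≤sum x∈) (m≤m+n d N)
    run₂′ : act (d + N) k v′ (α₂ , u₂) ≡ just y₂
    run₂′ = trans (sym (v≣v′ (d + N) s₂ s₂′ k 1≤k (<-≤-trans k<N (m≤n+m N d)) α₂ u₂ u₂-perm)) run₂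

proposition4p8 : (v v' : Word) → All ValidOp v → All ValidOp v' →
                 length v ≡ length v' →
                 v ≣ v' → ¬ IsZero v →
                 ∀ (x : ℕ) → (x ∈ supp v) ⇔ (x ∈ supp v')
proposition4p8 v v' valid valid' _ v≣v' v≢0 x = mk⇔
  (λ x∈v  → common-run (x ∈? supp v')
              λ s s' u-perm run run' → common-run⇒supp-⊆ v v' valid valid' s s' u-perm run run' x∈v)
  (λ x∈v' → common-run (x ∈? supp v)
              λ s s' u-perm run run' → common-run⇒supp-⊆ v' v valid' valid s' s u-perm run' run x∈v')
  where
  common-run = common-run-elim valid valid' v≣v' v≢0
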